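{- Let $H=(V,E)$ be a finite hypergraph with $n=|V|$ vertices, and let $\ell(H)$ be the maximum, over pairs of distinct vertices $x,y$, of the number of hyperedges containing both $x$ and $y$. In the Maker-Breaker scoring positional game on $H$, $$Ls(H)\geq \sum_{e\in E}2^{ -|e|}-\frac{n\,\ell(H)}{8}\qquad\text{and}\qquad Rs(H)\leq \sum_{e\in E}2^{ -|e|}.$$
   Context: Maker-Breaker scoring positional game on a finite hypergraph $H=(V,E)$: Left (Maker) and Right (Breaker) alternately claim a not yet claimed vertex until all vertices are claimed; the final value is the number of hyperedges all of whose vertices were claimed by Left, which Left maximizes and Right minimizes. $Ls(H)$ (resp. $Rs(H)$) is the final value under optimal play when Left (resp. Right) moves first. -}

module Defs where

open import Data.Nat using (ℕ; zero; suc; _⊔_; _⊓_; _^_; NonZero)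
open import Data.Nat.Properties using (m^n≢0)
open import Data.Bool using (Bool; true; false; _∧_; _∨_; not; if_then_else_)
open import Data.Fin using (Fin; _≟_)
open import Data.Fin.Subset using (Subset; ∣_∣)
open import Data.Vec using (lookup)
open import Data.List using (List; []; _∷_; foldr; length; filter; map; concatMap; allFin; filterᵇ)
open import Data.Integer using (ℤ; +_)
open import Data.Rational using (ℚ; 0ℚ; _+_; _/_)
open import Relation.Nullary using (¬?; does)

-- A finite hypergraph on vertex set Fin n; hyperedges are subsets of Fin n.
-- (Distinctness of hyperedges is imposed as a hypothesis in the statement.)
record Hypergraph : Set where
  field
    n     : ℕ
    edges : List (Subset n)
open Hypergraph public

data Cell : Set where
  free left right : Cell

data Player : Set where
  L R : Player

other : Player → Player
other L = R
other R = L

Board : ℕ → Set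
Board n = Fin n → Cell

isLeft : Cell → Bool
isLeft left = true
isLeft _    = false

isFree : Cell → Bool
isFree free = true
isFree _    = false

mark : Player → Cell
mark L = left
mark R = right

claim : ∀ {n} → Player → Fin n → Board n → Board n
claim p v b w = if does (v ≟ w) then mark p else b w

edgeAllLeft : ∀ {n} → Board n → Subset n → Bool
edgeAllLeft {n} b e = foldr (λ i acc → (not (lookup e i) ∨ isLeft (b i)) ∧ acc) true (allFin n)

score : ∀ {n} → List (Subset n) → Board n → ℕ
score E b = length (filterᵇ (edgeAllLeft b) E)

freeVertices : ∀ {n} → Board n → List (Fin n)
freeVertices {n} b = filterᵇ (λ i → isFree (b i)) (allFin n)

best : Player → ℕ → List ℕ → ℕ
best L x xs = foldr _⊔_ x xs
best R x xs = foldr _⊓_ x xs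

-- Optimal-play value with fuel k, player p to move, board b.
-- Game ends when no free vertex remains; the fuel n suffices since each move claims one vertex.
value : ∀ {n} → List (Subset n) → ℕ → Player → Board n → ℕ
value E zero    p b = score E b
value E (suc k) p b with freeVertices b
... | []     = score E b
... | v ∷ vs = best p (value E k (other p) (claim p v b))
                      (map (λ w → value E k (other p) (claim p w b)) vs)

emptyBoard : ∀ {n} → Board n
emptyBoard _ = free

Ls : Hypergraph → ℕ
Ls H = value (edges H) (n H) L emptyBoard

Rs : Hypergraph → ℕ
Rs H = value (edges H) (n H) R emptyBoard

codeg : (H : Hypergraph) → Fin (n H) → Fin (n H) → ℕ
codeg H x y = length (filterᵇ (λ e → lookup e x ∧ lookup e y) (edges H))

ell : Hypergraph → ℕ
ell H = foldr _⊔_ 0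
  (concatMap (λ x → map (codeg H x) (filterᵇ (λ y → not (does (x ≟ y))) (allFin (n H))))
             (allFin (n H)))

pow2inv : ℕ → ℚ
pow2inv k = (+ 1) / (2 ^ k)
  where instance _ = m^n≢0 2 k

weightSum : Hypergraph → ℚ
weightSum H = foldr (λ e acc → pow2inv ∣ e ∣ + acc) 0ℚ (edges H)

-- Erdős–Selfridge potential argument.  Give a hyperedge e the danger 2^(−#free vertices of e)
-- while Right owns none of its vertices, and 0 otherwise; the total danger starts at
-- ∑ 2^(−|e|) and ends at the score.  A Left move on x raises the total by the danger Φ(x)
-- of the edges through x, a Right move on y lowers it by Φ(y).  If Right always answers
-- at a vertex of maximum Φ, the total never increases over a round, giving the upper
-- bound on Rs.  If Left always plays at a vertex of maximum Φ, a round loses at most the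
-- danger of the edges through both moves, which is at most ℓ(H)/4; with n/2 rounds this
-- gives the lower bound on Ls.  All dangers are scaled by 2^n to stay in ℕ.
module Submission where

open import Defs
open import Algebra.Properties.CommutativeSemigroup as CSemigroup using ()
open import Data.Bool using (Bool; true; false; not; _∧_; _∨_; T)
open import Data.Empty using (⊥-elim)
open import Data.Fin using (Fin; _≟_) renaming (zero to fzero; suc to fsuc)
open import Data.Fin.Properties using (punchInᵢ≢i)
open import Data.Fin.Subset using (Subset; ∣_∣)
open import Data.Integer as ℤ using ()
import Data.Integer.Properties as ℤ
open import Data.List using (List; []; _∷_; foldr; length; map; filterᵇ; allFin)
open import Data.List.Extrema.Nat using (argmax; argmax-sel; f[⊥]≤f[argmax]; f[xs]≤f[argmax])
open import Data.List.Membership.Propositional using (_∈_)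
open import Data.List.Membership.Propositional.Properties
  using (∈-allFin; ∈-filter⁺; ∈-filter⁻; ∈-map⁺; ∈-map⁻; ∈-concatMap⁺; foldr-selective)
open import Data.List.Properties using (foldr-preservesᵒ; filter-all; length-tabulate)
open import Data.List.Relation.Unary.All as All using ()
open import Data.List.Relation.Unary.Any as Any using (Any; here; there)
open import Data.List.Relation.Unary.Unique.Propositional using (Unique)
open import Data.Nat
  using (ℕ; zero; suc; _+_; _*_; _^_; _≤_; _<_; _⊔_; _⊓_; z≤n; s≤s; s≤s⁻¹; NonZero)
open import Data.Nat.Properties hiding (_≟_)
open import Data.Nat.Tactic.RingSolver using (solve-∀)
open import Data.Product using (∃-syntax; _×_; _,_; proj₁; proj₂)
open import Data.Rational as ℚ using (0ℚ; toℚᵘ)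
import Data.Rational.Properties as ℚ
open import Data.Rational.Unnormalised as ℚᵘ using (*≡*; *≤*)
import Data.Rational.Unnormalised.Properties as ℚᵘ
open import Data.Sum using (_⊎_; inj₁; inj₂; [_,_])
open import Data.Vec using ([]; _∷_; lookup)
open import Data.Vec.Functional using (removeAt)
open import Function using (_∘_)
open import Relation.Binary.PropositionalEquality
  using (_≡_; _≢_; refl; sym; trans; cong; cong₂; subst; subst₂; module ≡-Reasoning)
open import Relation.Nullary using (¬_; does; yes; no)
open import Relation.Nullary.Decidable using (T?)

open import Algebra.Properties.CommutativeMonoid.Sum *-1-commutativeMonoid
  using () renaming (sum to ∏; sum-remove to ∏-remove; sum-cong-≗ to ∏-cong)
open CSemigroup +-commutativeSemigroup using (interchange; x∙yz≈xz∙y)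
open CSemigroup *-commutativeSemigroup using (x∙yz≈y∙xz)

private
  variable
    A : Set
    N : ℕ

-- Products, sums and maxima

∏-≤-^ : ∀ {m c} (f : Fin m → ℕ) → (∀ i → f i ≤ c) → ∏ f ≤ c ^ m
∏-≤-^ {zero}  f f≤c = ≤-refl
∏-≤-^ {suc m} f f≤c = *-mono-≤ (f≤c fzero) (∏-≤-^ (f ∘ fsuc) (f≤c ∘ fsuc))

∏-≡-^ : ∀ {m c} (f : Fin m → ℕ) → (∀ i → f i ≡ c) → ∏ f ≡ c ^ m
∏-≡-^ {zero}  f f≡c = refl
∏-≡-^ {suc m} f f≡c = cong₂ _*_ (f≡c fzero) (∏-≡-^ (f ∘ fsuc) (f≡c ∘ fsuc))

∏-zero : ∀ {m} (f : Fin m → ℕ) x → f x ≡ 0 → ∏ f ≡ 0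
∏-zero {suc m} f x fx≡0 = trans (∏-remove {i = x} f) (cong (_* ∏ (removeAt f x)) fx≡0)

∑ : List A → (A → ℕ) → ℕ
∑ []       f = 0
∑ (x ∷ xs) f = f x + ∑ xs f

∑-cong : ∀ (xs : List A) {f g} → (∀ x → f x ≡ g x) → ∑ xs f ≡ ∑ xs g
∑-cong []       f≡g = refl
∑-cong (x ∷ xs) f≡g = cong₂ _+_ (f≡g x) (∑-cong xs f≡g)

∑-mono-≤ : ∀ (xs : List A) {f g} → (∀ x → f x ≤ g x) → ∑ xs f ≤ ∑ xs g
∑-mono-≤ []       f≤g = z≤n
∑-mono-≤ (x ∷ xs) f≤g = +-mono-≤ (f≤g x) (∑-mono-≤ xs f≤g)

∑-+ : ∀ (xs : List A) f g → ∑ xs (λ x → f x + g x) ≡ ∑ xs f + ∑ xs g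
∑-+ []       f g = refl
∑-+ (x ∷ xs) f g = trans (cong (f x + g x +_) (∑-+ xs f g)) (interchange (f x) (g x) _ _)

∑-*ˡ : ∀ c (xs : List A) f → c * ∑ xs f ≡ ∑ xs (λ x → c * f x)
∑-*ˡ c []       f = *-zeroʳ c
∑-*ˡ c (x ∷ xs) f = trans (*-distribˡ-+ c (f x) _) (cong (c * f x +_) (∑-*ˡ c xs f))

infix 8 [_]·_

[_]·_ : Bool → ℕ → ℕ
[ true  ]· a = a
[ false ]· a = 0

[]·-+-∧ : ∀ u v a c → [ u ]· (a + [ v ]· c) ≡ [ u ]· a + [ u ∧ v ]· c
[]·-+-∧ true  v a c = refl
[]·-+-∧ false v a c = refl

∑-indicator : ∀ (p : A → Bool) xs c → ∑ xs (λ x → [ p x ]· c) ≡ length (filterᵇ p xs) * c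
∑-indicator p []       c = refl
∑-indicator p (x ∷ xs) c with p x
... | true  = cong (c +_) (∑-indicator p xs c)
... | false = ∑-indicator p xs c

length-filterᵇ-≤ : ∀ {p q : A → Bool} → (∀ a → T (q a) → T (p a)) →
                   ∀ xs → length (filterᵇ q xs) ≤ length (filterᵇ p xs)
length-filterᵇ-≤                 q⇒p []       = z≤n
length-filterᵇ-≤ {p = p} {q = q} q⇒p (y ∷ ys) with q y | p y | q⇒p y
... | true  | true  | _   = s≤s (length-filterᵇ-≤ q⇒p ys)
... | true  | false | q⇒p = ⊥-elim (q⇒p _)
... | false | true  | _   = m≤n⇒m≤1+n (length-filterᵇ-≤ q⇒p ys)
... | false | false | _   = length-filterᵇ-≤ q⇒p ys

length-filterᵇ-< : ∀ {p q : A → Bool} → (∀ a → T (q a) → T (p a)) →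
                   ∀ {x} xs → x ∈ xs → T (p x) → ¬ T (q x) →
                   length (filterᵇ q xs) < length (filterᵇ p xs)
length-filterᵇ-< {p = p} {q = q} q⇒p (y ∷ ys) (here refl) py ¬qy with q y | p y
... | true  | _     = ⊥-elim (¬qy _)
... | false | true  = s≤s (length-filterᵇ-≤ q⇒p ys)
length-filterᵇ-< {p = p} {q = q} q⇒p (y ∷ ys) (there x∈ys) px ¬qx
  with q y | p y | q⇒p y | length-filterᵇ-< q⇒p ys x∈ys px ¬qx
... | true  | true  | _   | ih = s≤s ih
... | true  | false | q⇒p | _  = ⊥-elim (q⇒p _)
... | false | true  | _   | ih = m≤n⇒m≤1+n ih
... | false | false | _   | ih = ih

foldr-∧-true : ∀ (q : A → Bool) xs {x} → foldr (λ a acc → q a ∧ acc) true xs ≡ true →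
               x ∈ xs → q x ≡ true
foldr-∧-true q (y ∷ ys) all≡true (here refl) with q y | all≡true
... | true | _ = refl
foldr-∧-true q (y ∷ ys) all≡true (there x∈ys) with q y | all≡true
... | true | rest≡true = foldr-∧-true q ys rest≡true x∈ys

foldr-∧-false : ∀ (q : A → Bool) xs → foldr (λ a acc → q a ∧ acc) true xs ≡ false →
                Any (λ x → q x ≡ false) xs
foldr-∧-false q (y ∷ ys) all≡false with q y in qy
... | true  = there (foldr-∧-false q ys all≡false)
... | false = here qy

∈-∷⁻ : ∀ {z e : A} {xs} → z ∈ e ∷ xs → z ≡ e ⊎ z ∈ xs
∈-∷⁻ (here z≡e)   = inj₁ z≡e
∈-∷⁻ (there z∈xs) = inj₂ z∈xs

∈-∷⁺ : ∀ {z e : A} {xs} → z ≡ e ⊎ z ∈ xs → z ∈ e ∷ xs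
∈-∷⁺ (inj₁ z≡e)  = here z≡e
∈-∷⁺ (inj₂ z∈xs) = there z∈xs

∈⇒≤-foldr-⊔ : ∀ {z e xs} → z ∈ e ∷ xs → z ≤ foldr _⊔_ e xs
∈⇒≤-foldr-⊔ {e = e} {xs} z∈ = foldr-preservesᵒ
  (λ x y → [ m≤n⇒m≤n⊔o y , m≤n⇒m≤o⊔n x ]) e xs
  (Data.Sum.map ≤-reflexive (Any.map ≤-reflexive) (∈-∷⁻ z∈))

∈⇒foldr-⊓-≤ : ∀ {z e xs} → z ∈ e ∷ xs → foldr _⊓_ e xs ≤ z
∈⇒foldr-⊓-≤ {e = e} {xs} z∈ = foldr-preservesᵒ
  (λ x y → [ m≤n⇒m⊓o≤n y , m≤n⇒o⊓m≤n x ]) e xs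
  (Data.Sum.map (≤-reflexive ∘ sym) (Any.map (≤-reflexive ∘ sym)) (∈-∷⁻ z∈))

best-∈ : ∀ p x xs → best p x xs ∈ x ∷ xs
best-∈ L x xs = ∈-∷⁺ (foldr-selective ⊔-sel x xs)
best-∈ R x xs = ∈-∷⁺ (foldr-selective ⊓-sel x xs)

argmax-∈ : ∀ (f : A → ℕ) v vs → argmax f v vs ∈ v ∷ vs
argmax-∈ f v vs = ∈-∷⁺ (argmax-sel f v vs)

argmax-max : ∀ (f : A → ℕ) v vs {z} → z ∈ v ∷ vs → f z ≤ f (argmax f v vs)
argmax-max f v vs (here refl)  = f[⊥]≤f[argmax] {f = f} v vs
argmax-max f v vs (there z∈vs) = All.lookup (f[xs]≤f[argmax] {f = f} v vs) z∈vs

-- Boards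

claim-self : ∀ p (x : Fin N) b → claim p x b x ≡ mark p
claim-self p x b with x ≟ x
... | yes _   = refl
... | no x≢x = ⊥-elim (x≢x refl)

claim-other : ∀ p {x y : Fin N} b → y ≢ x → claim p x b y ≡ b y
claim-other p {x} {y} b y≢x with x ≟ y
... | yes x≡y = ⊥-elim (y≢x (sym x≡y))
... | no _    = refl

mark≢free : ∀ p → mark p ≢ free
mark≢free L ()
mark≢free R ()

free-after-claim : ∀ p {x y : Fin N} b → claim p x b y ≡ free → y ≢ x × b y ≡ free
free-after-claim p {x} b y-free = y≢x , trans (sym (claim-other p b y≢x)) y-free
  where y≢x : _ ≢ x
        y≢x refl = mark≢free p (trans (sym (claim-self p x b)) y-free)

freeCount : Board N → ℕ
freeCount b = length (freeVertices b)

isFree⇒≡free : ∀ {c} → T (isFree c) → c ≡ free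
isFree⇒≡free {free} _ = refl

∈-freeVertices⁻ : ∀ (b : Board N) {x} → x ∈ freeVertices b → b x ≡ free
∈-freeVertices⁻ b x∈ = isFree⇒≡free (proj₂ (∈-filter⁻ (λ i → T? (isFree (b i))) {xs = allFin _} x∈))

∈-freeVertices⁺ : ∀ (b : Board N) {x} → b x ≡ free → x ∈ freeVertices b
∈-freeVertices⁺ b {x} x-free =
  ∈-filter⁺ (λ i → T? (isFree (b i))) {xs = allFin _} (∈-allFin x) (subst (T ∘ isFree) (sym x-free) _)

freeCount-claim : ∀ p {x : Fin N} b → b x ≡ free → freeCount (claim p x b) < freeCount b
freeCount-claim {N} p {x} b x-free = length-filterᵇ-< still-free (allFin N) (∈-allFin x)
  (subst (T ∘ isFree) (sym x-free) _) (subst (¬_ ∘ T ∘ isFree) (sym (claim-self p x b)) (not-free p))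
  where
  not-free : ∀ p → ¬ T (isFree (mark p))
  not-free L ()
  not-free R ()
  still-free : ∀ i → T (isFree (claim p x b i)) → T (isFree (b i))
  still-free i t = subst (T ∘ isFree) (sym (proj₂ (free-after-claim p {x} {i} b (isFree⇒≡free t)))) _

freeCount-emptyBoard : freeCount (emptyBoard {N}) ≡ N
freeCount-emptyBoard {N} = trans
  (cong length (filter-all (T? ∘ isFree ∘ emptyBoard {N}) {allFin N} (All.universal _ (allFin N))))
  (length-tabulate {n = N} (λ i → i))

freeVertices-[] : ∀ {b : Board N} → freeVertices b ≡ [] → ∀ x → b x ≢ free
freeVertices-[] {b = b} none x x-free with () ← subst (x ∈_) none (∈-freeVertices⁺ b x-free)

-- Weights

cellFactor : Bool → Cell → ℕ
cellFactor false _     = 2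
cellFactor true  free  = 1
cellFactor true  left  = 2
cellFactor true  right = 0

cellFactor-≤ : ∀ v c → cellFactor v c ≤ 2
cellFactor-≤ false _     = ≤-refl
cellFactor-≤ true  free  = s≤s z≤n
cellFactor-≤ true  left  = ≤-refl
cellFactor-≤ true  right = z≤n

cellFactor-allLeft : ∀ v c → not v ∨ isLeft c ≡ true → cellFactor v c ≡ 2
cellFactor-allLeft false _    _ = refl
cellFactor-allLeft true  left _ = refl

cellFactor-notAllLeft : ∀ v c → c ≢ free → not v ∨ isLeft c ≡ false → cellFactor v c ≡ 0
cellFactor-notAllLeft true free  c≢free _ = ⊥-elim (c≢free refl)
cellFactor-notAllLeft true right _      _ = refl

-- weight b e = 2^N · 2^(−#free vertices of e) if Right owns no vertex of e, and 0 otherwise.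
weight : Board N → Subset N → ℕ
weight b e = ∏ (λ i → cellFactor (lookup e i) (b i))

weight-≤ : ∀ (b : Board N) e → weight b e ≤ 2 ^ N
weight-≤ b e = ∏-≤-^ _ (λ i → cellFactor-≤ (lookup e i) (b i))

weight-claim : ∀ p (x : Fin N) b e →
  cellFactor (lookup e x) (b x) * weight (claim p x b) e ≡ cellFactor (lookup e x) (mark p) * weight b e
weight-claim {suc N} p x b e = begin
  F x * ∏ F′                        ≡⟨ cong (F x *_) (∏-remove {i = x} F′) ⟩
  F x * (F′ x * ∏ (removeAt F′ x)) ≡⟨ cong (λ r → F x * (F′ x * r)) rest ⟩
  F x * (F′ x * ∏ (removeAt F x))  ≡⟨ x∙yz≈y∙xz (F x) (F′ x) _ ⟩
  F′ x * (F x * ∏ (removeAt F x))  ≡⟨ cong₂ _*_ (cong (cellFactor (lookup e x)) (claim-self p x b))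
                                               (sym (∏-remove {i = x} F)) ⟩
  cellFactor (lookup e x) (mark p) * ∏ F ∎
  where
  open ≡-Reasoning
  F F′ : Fin (suc N) → ℕ
  F  i = cellFactor (lookup e i) (b i)
  F′ i = cellFactor (lookup e i) (claim p x b i)
  rest : ∏ (removeAt F′ x) ≡ ∏ (removeAt F x)
  rest = ∏-cong (λ j → cong (cellFactor _) (claim-other p b (punchInᵢ≢i x j)))

weight-claim-∈ : ∀ p (x : Fin N) b e → lookup e x ≡ true → b x ≡ free →
                 weight (claim p x b) e ≡ cellFactor true (mark p) * weight b e
weight-claim-∈ p x b e x∈e x-free with weight-claim p x b e
... | eq rewrite x∈e | x-free = trans (sym (*-identityˡ _)) eq

weight-claim-∉ : ∀ p (x : Fin N) b e → lookup e x ≡ false → weight (claim p x b) e ≡ weight b e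
weight-claim-∉ p x b e x∉e with weight-claim p x b e
... | eq rewrite x∉e = *-cancelˡ-≡ _ _ 2 eq

weight-claimL : ∀ {x : Fin N} {b} e → b x ≡ free →
                weight (claim L x b) e ≡ weight b e + [ lookup e x ]· weight b e
weight-claimL {x = x} {b} e x-free with lookup e x in x∈e
... | true  = trans (weight-claim-∈ L x b e x∈e x-free) (cong (weight b e +_) (+-identityʳ _))
... | false = trans (weight-claim-∉ L x b e x∈e) (sym (+-identityʳ _))

weight-claimR : ∀ {x : Fin N} {b} e → b x ≡ free →
                weight (claim R x b) e + [ lookup e x ]· weight b e ≡ weight b e
weight-claimR {x = x} {b} e x-free with lookup e x in x∈e
... | true  = cong (_+ weight b e) (weight-claim-∈ R x b e x∈e x-free)
... | false = trans (+-identityʳ _) (weight-claim-∉ R x b e x∈e)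

weight-two-free : ∀ {x y : Fin N} {b} e → x ≢ y → b x ≡ free → b y ≡ free →
                  lookup e x ≡ true → lookup e y ≡ true → 4 * weight b e ≤ 2 ^ N
weight-two-free {N} {x} {y} {b} e x≢y x-free y-free x∈e y∈e = begin
  4 * weight b e                   ≡⟨ *-assoc 2 2 (weight b e) ⟩
  2 * (2 * weight b e)             ≡⟨ cong (2 *_) (weight-claim-∈ L x b e x∈e x-free) ⟨
  2 * weight (claim L x b) e       ≡⟨ weight-claim-∈ L y _ e y∈e (trans (claim-other L b (x≢y ∘ sym)) y-free) ⟨
  weight (claim L y (claim L x b)) e ≤⟨ weight-≤ _ e ⟩
  2 ^ N                            ∎
  where open ≤-Reasoning

weight-allLeft : ∀ (b : Board N) e → edgeAllLeft b e ≡ true → weight b e ≡ 2 ^ N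
weight-allLeft {N} b e all =
  ∏-≡-^ _ (λ i → cellFactor-allLeft _ _ (foldr-∧-true _ (allFin N) all (∈-allFin i)))

weight-notAllLeft : ∀ (b : Board N) e → (∀ x → b x ≢ free) → edgeAllLeft b e ≡ false → weight b e ≡ 0
weight-notAllLeft {N} b e full notAll with Any.satisfied (foldr-∧-false _ (allFin N) notAll)
... | i , i-bad = ∏-zero _ i (cellFactor-notAllLeft _ _ (full i) i-bad)

weight-emptyBoard : ∀ {N} (e : Subset N) → weight emptyBoard e * 2 ^ ∣ e ∣ ≡ 2 ^ N
weight-emptyBoard []          = refl
weight-emptyBoard {suc N} (true ∷ e)  = begin
  1 * weight emptyBoard e * (2 * 2 ^ ∣ e ∣) ≡⟨ cong (_* (2 * 2 ^ ∣ e ∣)) (*-identityˡ (weight emptyBoard e)) ⟩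
  weight emptyBoard e * (2 * 2 ^ ∣ e ∣)     ≡⟨ x∙yz≈y∙xz (weight emptyBoard e) 2 _ ⟩
  2 * (weight emptyBoard e * 2 ^ ∣ e ∣)     ≡⟨ cong (2 *_) (weight-emptyBoard e) ⟩
  2 * 2 ^ N                                 ∎
  where open ≡-Reasoning
weight-emptyBoard (false ∷ e) = trans (*-assoc 2 (weight emptyBoard e) _) (cong (2 *_) (weight-emptyBoard e))

-- Potentials

module _ {N : ℕ} (E : List (Subset N)) where

  Ψ : Board N → ℕ
  Ψ b = ∑ E (weight b)

  Φ : Board N → Fin N → ℕ
  Φ b x = ∑ E (λ e → [ lookup e x ]· weight b e)

  Φ₂ : Board N → Fin N → Fin N → ℕ
  Φ₂ b x y = ∑ E (λ e → [ lookup e x ∧ lookup e y ]· weight b e)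

  codegree : Fin N → Fin N → ℕ
  codegree x y = length (filterᵇ (λ e → lookup e x ∧ lookup e y) E)

  Ψ-claimL : ∀ {x b} → b x ≡ free → Ψ (claim L x b) ≡ Ψ b + Φ b x
  Ψ-claimL x-free = trans (∑-cong E (λ e → weight-claimL e x-free)) (∑-+ E _ _)

  Ψ-claimR : ∀ {x b} → b x ≡ free → Ψ (claim R x b) + Φ b x ≡ Ψ b
  Ψ-claimR x-free = trans (sym (∑-+ E _ _)) (∑-cong E (λ e → weight-claimR e x-free))

  Φ-claimL : ∀ {x b} y → b x ≡ free → Φ (claim L x b) y ≡ Φ b y + Φ₂ b y x
  Φ-claimL {x} {b} y x-free = trans (∑-cong E edge) (∑-+ E _ _)
    where
    edge : ∀ e → [ lookup e y ]· weight (claim L x b) e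
                 ≡ [ lookup e y ]· weight b e + [ lookup e y ∧ lookup e x ]· weight b e
    edge e = trans (cong ([ lookup e y ]·_) (weight-claimL e x-free)) ([]·-+-∧ (lookup e y) (lookup e x) _ _)

  Φ-claimR : ∀ {y b} x → b y ≡ free → Φ (claim R y b) x + Φ₂ b x y ≡ Φ b x
  Φ-claimR {y} {b} x y-free = trans (sym (∑-+ E _ _)) (∑-cong E edge)
    where
    edge : ∀ e → [ lookup e x ]· weight (claim R y b) e + [ lookup e x ∧ lookup e y ]· weight b e
                 ≡ [ lookup e x ]· weight b e
    edge e = trans (sym ([]·-+-∧ (lookup e x) (lookup e y) _ _)) (cong ([ lookup e x ]·_) (weight-claimR e y-free))

  Φ₂-≤ : ∀ {x y b} → x ≢ y → b x ≡ free → b y ≡ free → 4 * Φ₂ b x y ≤ codegree x y * 2 ^ N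
  Φ₂-≤ {x} {y} {b} x≢y x-free y-free = begin
    4 * Φ₂ b x y                                        ≡⟨ ∑-*ˡ 4 E _ ⟩
    ∑ E (λ e → 4 * [ lookup e x ∧ lookup e y ]· weight b e) ≤⟨ ∑-mono-≤ E edge ⟩
    ∑ E (λ e → [ lookup e x ∧ lookup e y ]· 2 ^ N)     ≡⟨ ∑-indicator _ E _ ⟩
    codegree x y * 2 ^ N                                ∎
    where
    open ≤-Reasoning
    edge : ∀ e → 4 * [ lookup e x ∧ lookup e y ]· weight b e ≤ [ lookup e x ∧ lookup e y ]· 2 ^ N
    edge e with lookup e x in x∈e | lookup e y in y∈e
    ... | true  | true  = weight-two-free e x≢y x-free y-free x∈e y∈e
    ... | true  | false = z≤n
    ... | false | _     = z≤n

  score-≤-Ψ : ∀ b → score E b * 2 ^ N ≤ Ψ b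
  score-≤-Ψ b = begin
    score E b * 2 ^ N                          ≡⟨ ∑-indicator (edgeAllLeft b) E _ ⟨
    ∑ E (λ e → [ edgeAllLeft b e ]· 2 ^ N)    ≤⟨ ∑-mono-≤ E edge ⟩
    Ψ b                                        ∎
    where
    open ≤-Reasoning
    edge : ∀ e → [ edgeAllLeft b e ]· 2 ^ N ≤ weight b e
    edge e with edgeAllLeft b e in all
    ... | true  = ≤-reflexive (sym (weight-allLeft b e all))
    ... | false = z≤n

  Ψ-settled : ∀ {b} → freeVertices b ≡ [] → Ψ b ≡ score E b * 2 ^ N
  Ψ-settled {b} none = trans (∑-cong E edge) (∑-indicator (edgeAllLeft b) E _)
    where
    edge : ∀ e → weight b e ≡ [ edgeAllLeft b e ]· 2 ^ N
    edge e with edgeAllLeft b e in all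
    ... | true  = weight-allLeft b e all
    ... | false = weight-notAllLeft b e (freeVertices-[] none) all

  afterMove : ℕ → Player → Board N → Fin N → ℕ
  afterMove k p b w = value E k (other p) (claim p w b)

  value-over : ∀ k p {b} → freeVertices b ≡ [] → value E k p b ≡ score E b
  value-over zero    p none = refl
  value-over (suc k) p none rewrite none = refl

  value-step : ∀ k p {b v vs} → freeVertices b ≡ v ∷ vs →
               value E (suc k) p b ≡ best p (afterMove k p b v) (map (afterMove k p b) vs)
  value-step k p eq rewrite eq = refl

  value-attained : ∀ k p {b v vs} → freeVertices b ≡ v ∷ vs →
                   ∃[ w ] w ∈ freeVertices b × value E (suc k) p b ≡ afterMove k p b w
  value-attained k p {b} {v} {vs} eq
    with ∈-map⁻ (afterMove k p b) (best-∈ p (afterMove k p b v) (map (afterMove k p b) vs))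
  ... | w , w∈ , best≡ = w , subst (w ∈_) (sym eq) w∈ , trans (value-step k p eq) best≡

  value-L-≥ : ∀ k {b w} → w ∈ freeVertices b → afterMove k L b w ≤ value E (suc k) L b
  value-L-≥ k {b} {w} w∈ with freeVertices b
  ... | _ ∷ _ = ∈⇒≤-foldr-⊔ (∈-map⁺ (afterMove k L b) w∈)

  value-R-≤ : ∀ k {b w} → w ∈ freeVertices b → value E (suc k) R b ≤ afterMove k R b w
  value-R-≤ k {b} {w} w∈ with freeVertices b
  ... | _ ∷ _ = ∈⇒foldr-⊓-≤ (∈-map⁺ (afterMove k R b) w∈)

  value-settled : ∀ k p {b} → freeVertices b ≡ [] → value E k p b * 2 ^ N ≡ Ψ b
  value-settled k p none = trans (cong (_* 2 ^ N) (value-over k p none)) (sym (Ψ-settled none))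

  freeVertices-cases : ∀ (b : Board N) → freeVertices b ≡ [] ⊎ ∃[ v ] ∃[ vs ] freeVertices b ≡ v ∷ vs
  freeVertices-cases b with freeVertices b
  ... | []     = inj₁ refl
  ... | v ∷ vs = inj₂ (v , vs , refl)

  -- Right answers every move at a free vertex of maximum Φ.
  value-R-≤-Ψ : ∀ k b → value E k R b * 2 ^ N ≤ Ψ b
  value-L-≤ : ∀ k b {B} → Ψ b ≤ B → (∀ {x} → b x ≡ free → Ψ b + Φ b x ≤ B) → value E k L b * 2 ^ N ≤ B

  value-R-≤-Ψ zero    b = score-≤-Ψ b
  value-R-≤-Ψ (suc k) b with freeVertices-cases b
  ... | inj₁ none           = ≤-reflexive (value-settled (suc k) R none)
  ... | inj₂ (v , vs , eq) = begin
    value E (suc k) R b * 2 ^ N ≤⟨ *-monoˡ-≤ (2 ^ N) (value-R-≤ k y∈) ⟩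
    value E k L b′ * 2 ^ N      ≤⟨ value-L-≤ k b′ (m+n≤o⇒m≤o _ (≤-reflexive (Ψ-claimR y-free))) bound ⟩
    Ψ b                         ∎
    where
    open ≤-Reasoning
    y = argmax (Φ b) v vs
    y∈ : y ∈ freeVertices b
    y∈ = subst (y ∈_) (sym eq) (argmax-∈ (Φ b) v vs)
    y-free : b y ≡ free
    y-free = ∈-freeVertices⁻ b y∈
    b′ = claim R y b
    bound : ∀ {x} → b′ x ≡ free → Ψ b′ + Φ b′ x ≤ Ψ b
    bound {x} x-free′ = begin
      Ψ b′ + Φ b′ x ≤⟨ +-monoʳ-≤ (Ψ b′) (m+n≤o⇒m≤o _ (≤-reflexive (Φ-claimR x y-free))) ⟩
      Ψ b′ + Φ b x  ≤⟨ +-monoʳ-≤ (Ψ b′) (argmax-max (Φ b) v vs (subst (x ∈_) eq x∈)) ⟩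
      Ψ b′ + Φ b y  ≡⟨ Ψ-claimR y-free ⟩
      Ψ b           ∎
      where x∈ = ∈-freeVertices⁺ b (proj₂ (free-after-claim R {y} {x} b x-free′))

  value-L-≤ zero    b Ψ≤B _ = ≤-trans (score-≤-Ψ b) Ψ≤B
  value-L-≤ (suc k) b Ψ≤B _ with freeVertices-cases b
  value-L-≤ (suc k) b Ψ≤B _     | inj₁ none = ≤-trans (≤-reflexive (value-settled (suc k) L none)) Ψ≤B
  value-L-≤ (suc k) b {B} _ move≤B | inj₂ (_ , _ , eq) with value-attained k L eq
  ... | x , x∈ , value≡ = begin
    value E (suc k) L b * 2 ^ N ≡⟨ cong (_* 2 ^ N) value≡ ⟩
    afterMove k L b x * 2 ^ N   ≤⟨ value-R-≤-Ψ k (claim L x b) ⟩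
    Ψ (claim L x b)             ≡⟨ Ψ-claimL x-free ⟩
    Ψ b + Φ b x                 ≤⟨ move≤B x-free ⟩
    B                           ∎
    where
    open ≤-Reasoning
    x-free : b x ≡ free
    x-free = ∈-freeVertices⁻ b x∈

  Ψ-round : ∀ {b x y} → b x ≡ free → claim L x b y ≡ free → Φ b y ≤ Φ b x →
            Ψ b ≤ Ψ (claim R y (claim L x b)) + Φ₂ b y x
  Ψ-round {b} {x} {y} x-free y-free′ y≤x = +-cancelʳ-≤ (Φ b x) _ _ (begin
    Ψ b + Φ b x                 ≡⟨ Ψ-claimL x-free ⟨
    Ψ b₁                        ≡⟨ Ψ-claimR y-free′ ⟨
    Ψ b₂ + Φ b₁ y               ≡⟨ cong (Ψ b₂ +_) (Φ-claimL y x-free) ⟩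
    Ψ b₂ + (Φ b y + Φ₂ b y x)   ≤⟨ +-monoʳ-≤ (Ψ b₂) (+-monoˡ-≤ (Φ₂ b y x) y≤x) ⟩
    Ψ b₂ + (Φ b x + Φ₂ b y x)   ≡⟨ x∙yz≈xz∙y (Ψ b₂) (Φ b x) (Φ₂ b y x) ⟩
    Ψ b₂ + Φ₂ b y x + Φ b x     ∎)
    where
    open ≤-Reasoning
    b₁ = claim L x b
    b₂ = claim R y b₁

  -- Left plays at a free vertex of maximum Φ; each free vertex then costs at most ℓ·2^N/8.
  module _ (ℓ : ℕ) (codegree-≤ : ∀ {x y} → x ≢ y → codegree x y ≤ ℓ) where

    round-loss : ∀ {b x y} → b x ≡ free → claim L x b y ≡ free → Φ b y ≤ Φ b x →
                 8 * Ψ b ≤ 8 * Ψ (claim R y (claim L x b)) + 2 * (ℓ * 2 ^ N)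
    round-loss {b} {x} {y} x-free y-free′ y≤x = begin
      8 * Ψ b                                ≤⟨ *-monoʳ-≤ 8 (Ψ-round x-free y-free′ y≤x) ⟩
      8 * (Ψ b₂ + Φ₂ b y x)                  ≡⟨ *-distribˡ-+ 8 (Ψ b₂) _ ⟩
      8 * Ψ b₂ + 8 * Φ₂ b y x                ≡⟨ cong (8 * Ψ b₂ +_) (*-assoc 2 4 (Φ₂ b y x)) ⟩
      8 * Ψ b₂ + 2 * (4 * Φ₂ b y x)          ≤⟨ +-monoʳ-≤ (8 * Ψ b₂) (*-monoʳ-≤ 2 codegree-bound) ⟩
      8 * Ψ b₂ + 2 * (ℓ * 2 ^ N)             ∎
      where
      open ≤-Reasoning
      b₂ = claim R y (claim L x b)
      y≢x-free = free-after-claim L {x} {y} b y-free′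
      codegree-bound : 4 * Φ₂ b y x ≤ ℓ * 2 ^ N
      codegree-bound = ≤-trans (Φ₂-≤ (proj₁ y≢x-free) (proj₂ y≢x-free) x-free)
                               (*-monoˡ-≤ (2 ^ N) (codegree-≤ (proj₁ y≢x-free)))

    greedy : ∀ k b → freeCount b ≤ k →
             8 * Ψ b ≤ 8 * (value E k L b * 2 ^ N) + freeCount b * (ℓ * 2 ^ N)
    afterGreedy : ∀ k b {x} → b x ≡ free → (∀ {y} → b y ≡ free → Φ b y ≤ Φ b x) → freeCount b ≤ suc k →
                  8 * Ψ b ≤ 8 * (afterMove k L b x * 2 ^ N) + freeCount b * (ℓ * 2 ^ N)

    greedy k b count≤ with freeVertices-cases b
    ... | inj₁ none = ≤-trans (≤-reflexive (cong (8 *_) (sym (value-settled k L none)))) (m≤m+n _ _)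
    greedy zero    b count≤ | inj₂ (_ , _ , eq) with () ← subst (_≤ 0) (cong length eq) count≤
    greedy (suc k) b count≤ | inj₂ (v , vs , eq) = begin
      8 * Ψ b                                                      ≤⟨ afterGreedy k b x-free x-max count≤ ⟩
      8 * (afterMove k L b x * 2 ^ N) + freeCount b * (ℓ * 2 ^ N)
        ≤⟨ +-monoˡ-≤ _ (*-monoʳ-≤ 8 (*-monoˡ-≤ (2 ^ N) (value-L-≥ k x∈))) ⟩
      8 * (value E (suc k) L b * 2 ^ N) + freeCount b * (ℓ * 2 ^ N) ∎
      where
      open ≤-Reasoning
      x = argmax (Φ b) v vs
      x∈ : x ∈ freeVertices b
      x∈ = subst (x ∈_) (sym eq) (argmax-∈ (Φ b) v vs)
      x-free : b x ≡ free
      x-free = ∈-freeVertices⁻ b x∈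
      x-max : ∀ {y} → b y ≡ free → Φ b y ≤ Φ b x
      x-max y-free = argmax-max (Φ b) v vs (subst (_ ∈_) eq (∈-freeVertices⁺ b y-free))

    afterGreedy k b {x} x-free x-max count≤ with freeVertices-cases (claim L x b)
    ... | inj₁ none = begin
      8 * Ψ b                                  ≤⟨ *-monoʳ-≤ 8 (m≤m+n (Ψ b) (Φ b x)) ⟩
      8 * (Ψ b + Φ b x)                        ≡⟨ cong (8 *_) (Ψ-claimL x-free) ⟨
      8 * Ψ (claim L x b)                      ≡⟨ cong (8 *_) (value-settled k R none) ⟨
      8 * (afterMove k L b x * 2 ^ N)          ≤⟨ m≤m+n _ _ ⟩
      8 * (afterMove k L b x * 2 ^ N) + _     ∎
      where open ≤-Reasoning
    afterGreedy zero b {x} x-free x-max count≤ | inj₂ (_ , _ , eq)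
      with s≤s () ← ≤-trans (subst (_< freeCount b) (cong length eq) (freeCount-claim L b x-free)) count≤
    afterGreedy (suc k) b {x} x-free x-max count≤ | inj₂ (_ , _ , eq) with value-attained k R eq
    ... | y , y∈ , value≡ = begin
      8 * Ψ b                                        ≤⟨ round-loss x-free y-free′ y≤x ⟩
      8 * Ψ b₂ + 2 * Q                               ≤⟨ +-monoˡ-≤ (2 * Q) (greedy k b₂ count₂≤) ⟩
      8 * (v₂ * 2 ^ N) + freeCount b₂ * Q + 2 * Q    ≡⟨ collect (8 * (v₂ * 2 ^ N)) (freeCount b₂) Q ⟩
      8 * (v₂ * 2 ^ N) + (2 + freeCount b₂) * Q      ≤⟨ +-monoʳ-≤ _ (*-monoˡ-≤ Q two-fewer) ⟩
      8 * (v₂ * 2 ^ N) + freeCount b * Q             ≡⟨ cong (λ v → 8 * (v * 2 ^ N) + freeCount b * Q) value≡ ⟨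
      8 * (afterMove (suc k) L b x * 2 ^ N) + freeCount b * Q ∎
      where
      open ≤-Reasoning
      Q = ℓ * 2 ^ N
      b₁ = claim L x b
      b₂ = claim R y b₁
      v₂ = value E k L b₂
      y-free′ : b₁ y ≡ free
      y-free′ = ∈-freeVertices⁻ b₁ y∈
      y≤x : Φ b y ≤ Φ b x
      y≤x = x-max (proj₂ (free-after-claim L {x} {y} b y-free′))
      two-fewer : 2 + freeCount b₂ ≤ freeCount b
      two-fewer = ≤-trans (s≤s (freeCount-claim R b₁ y-free′)) (freeCount-claim L b x-free)
      count₂≤ : freeCount b₂ ≤ k
      count₂≤ = s≤s⁻¹ (s≤s⁻¹ (≤-trans two-fewer count≤))
      collect : ∀ a c q → a + c * q + 2 * q ≡ a + (2 + c) * q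
      collect = solve-∀

-- Rational bookkeeping

toℚᵘ-/ : ∀ i d .{{_ : NonZero d}} → toℚᵘ (i ℚ./ d) ℚᵘ.≃ i ℚᵘ./ d
toℚᵘ-/ i (suc d) = ℚ.toℚᵘ-fromℚᵘ (ℚᵘ.mkℚᵘ i d)

/-mono-≤ : ∀ a d c d′ .{{_ : NonZero d}} .{{_ : NonZero d′}} →
           a * d′ ≤ c * d → ℤ.+ a ℚ./ d ℚ.≤ ℤ.+ c ℚ./ d′
/-mono-≤ a d@(suc _) c d′@(suc _) ad′≤cd = ℚ.toℚᵘ-cancel-≤ (begin
  toℚᵘ (ℤ.+ a ℚ./ d)  ≃⟨ toℚᵘ-/ (ℤ.+ a) d ⟩
  ℤ.+ a ℚᵘ./ d        ≤⟨ *≤* (subst₂ ℤ._≤_ (ℤ.pos-* a d′) (ℤ.pos-* c d) (ℤ.+≤+ ad′≤cd)) ⟩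
  ℤ.+ c ℚᵘ./ d′       ≃⟨ toℚᵘ-/ (ℤ.+ c) d′ ⟨
  toℚᵘ (ℤ.+ c ℚ./ d′) ∎)
  where open ℚᵘ.≤-Reasoning

/-≡ : ∀ a d c d′ .{{_ : NonZero d}} .{{_ : NonZero d′}} →
      a * d′ ≡ c * d → ℤ.+ a ℚ./ d ≡ ℤ.+ c ℚ./ d′
/-≡ a d c d′ ad′≡cd =
  ℚ.≤-antisym (/-mono-≤ a d c d′ (≤-reflexive ad′≡cd)) (/-mono-≤ c d′ a d (≤-reflexive (sym ad′≡cd)))

/-+-/ : ∀ a d c d′ .{{_ : NonZero d}} .{{_ : NonZero d′}} →
        ℤ.+ a ℚ./ d ℚ.+ ℤ.+ c ℚ./ d′ ≡ (ℤ.+ (a * d′ + c * d) ℚ./ (d * d′)) {{m*n≢0 d d′}}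
/-+-/ a d@(suc _) c d′@(suc _) = ℚ.toℚᵘ-injective (begin
  toℚᵘ (ℤ.+ a ℚ./ d ℚ.+ ℤ.+ c ℚ./ d′)          ≈⟨ ℚ.toℚᵘ-homo-+ (ℤ.+ a ℚ./ d) _ ⟩
  toℚᵘ (ℤ.+ a ℚ./ d) ℚᵘ.+ toℚᵘ (ℤ.+ c ℚ./ d′)  ≈⟨ ℚᵘ.+-cong (toℚᵘ-/ (ℤ.+ a) d) (toℚᵘ-/ (ℤ.+ c) d′) ⟩
  ℤ.+ a ℚᵘ./ d ℚᵘ.+ ℤ.+ c ℚᵘ./ d′              ≈⟨ *≡* (cong (ℤ._* ℤ.+ (d * d′)) numerator) ⟩
  ℤ.+ (a * d′ + c * d) ℚᵘ./ (d * d′)           ≈⟨ toℚᵘ-/ (ℤ.+ (a * d′ + c * d)) (d * d′) ⟨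
  toℚᵘ (ℤ.+ (a * d′ + c * d) ℚ./ (d * d′))     ∎)
  where
  open import Relation.Binary.Reasoning.Setoid ℚᵘ.≃-setoid
  numerator : ℤ.+ a ℤ.* ℤ.+ d′ ℤ.+ ℤ.+ c ℤ.* ℤ.+ d ≡ ℤ.+ (a * d′ + c * d)
  numerator = sym (trans (ℤ.pos-+ (a * d′) (c * d)) (cong₂ ℤ._+_ (ℤ.pos-* a d′) (ℤ.pos-* c d)))

p≤q+r⇒p-r≤q : ∀ {p q r} → p ℚ.≤ q ℚ.+ r → p ℚ.- r ℚ.≤ q
p≤q+r⇒p-r≤q {p} {q} {r} p≤q+r = begin
  p ℚ.- r             ≤⟨ ℚ.+-monoˡ-≤ (ℚ.- r) p≤q+r ⟩
  q ℚ.+ r ℚ.- r       ≡⟨ ℚ.+-assoc q r (ℚ.- r) ⟩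
  q ℚ.+ (r ℚ.- r)     ≡⟨ cong (q ℚ.+_) (ℚ.+-inverseʳ r) ⟩
  q ℚ.+ 0ℚ            ≡⟨ ℚ.+-identityʳ q ⟩
  q                   ∎
  where open ℚ.≤-Reasoning

weightSum-≡ : ∀ {N} (E : List (Subset N)) →
              foldr (λ e acc → pow2inv ∣ e ∣ ℚ.+ acc) 0ℚ E ≡ (ℤ.+ Ψ E emptyBoard ℚ./ 2 ^ N) {{m^n≢0 2 N}}
weightSum-≡ {N} []      = /-≡ 0 1 0 (2 ^ N) refl
  where instance _ = m^n≢0 2 N
weightSum-≡ {N} (e ∷ E) = begin
  pow2inv ∣ e ∣ ℚ.+ foldr (λ e acc → pow2inv ∣ e ∣ ℚ.+ acc) 0ℚ E ≡⟨ cong₂ ℚ._+_ edge (weightSum-≡ E) ⟩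
  ℤ.+ w ℚ./ P ℚ.+ ℤ.+ W ℚ./ P                                     ≡⟨ /-+-/ w P W P ⟩
  (ℤ.+ (w * P + W * P) ℚ./ (P * P)) {{m*n≢0 P P}}
    ≡⟨ /-≡ (w * P + W * P) (P * P) (w + W) P {{m*n≢0 P P}} rearrange ⟩
  ℤ.+ (w + W) ℚ./ P                                               ∎
  where
  open ≡-Reasoning
  P = 2 ^ N
  instance _ = m^n≢0 2 N
  w = weight emptyBoard e
  W = Ψ E emptyBoard
  edge : pow2inv ∣ e ∣ ≡ ℤ.+ w ℚ./ P
  edge = /-≡ 1 (2 ^ ∣ e ∣) w P {{m^n≢0 2 ∣ e ∣}} (trans (*-identityˡ P) (sym (weight-emptyBoard e)))
  rearrange : (w * P + W * P) * P ≡ (w + W) * (P * P)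
  rearrange = trans (cong (_* P) (sym (*-distribʳ-+ P w W))) (*-assoc (w + W) P P)

codeg-≤-ell : ∀ H {x y : Fin (n H)} → x ≢ y → codeg H x y ≤ ell H
codeg-≤-ell H {x} {y} x≢y = ∈⇒≤-foldr-⊔ (there (∈-concatMap⁺ rowOf (Any.map (λ { refl → row }) (∈-allFin x))))
  where
  rowOf : Fin (n H) → List ℕ
  rowOf x = map (codeg H x) (filterᵇ (λ y → not (does (x ≟ y))) (allFin (n H)))
  distinct : T (not (does (x ≟ y)))
  distinct with x ≟ y
  ... | yes x≡y = x≢y x≡y
  ... | no _    = _
  row : codeg H x y ∈ rowOf x
  row = ∈-map⁺ (codeg H x) (∈-filter⁺ (T? ∘ λ y → not (does (x ≟ y))) {xs = allFin _} (∈-allFin y) distinct)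

Ls-bound : ∀ H → 8 * Ψ (edges H) emptyBoard ≤ 8 * (Ls H * 2 ^ n H) + n H * (ell H * 2 ^ n H)
Ls-bound H = subst (λ c → 8 * Ψ (edges H) emptyBoard ≤ 8 * (Ls H * 2 ^ n H) + c * (ell H * 2 ^ n H))
  (freeCount-emptyBoard {n H})
  (greedy (edges H) (ell H) (codeg-≤-ell H) (n H) emptyBoard (≤-reflexive (freeCount-emptyBoard {n H})))

mainTheorem7 : (H : Hypergraph) → Unique (edges H) →
    ((weightSum H ℚ.- ((ℤ.+ (n H * ell H)) ℚ./ 8)) ℚ.≤ ((ℤ.+ (Ls H)) ℚ./ 1))
    × (((ℤ.+ (Rs H)) ℚ./ 1) ℚ.≤ weightSum H)
mainTheorem7 H _ = p≤q+r⇒p-r≤q lower , upper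
  where
  open ℚ.≤-Reasoning
  instance _ = m^n≢0 2 (n H)
  Ψ₀ = Ψ (edges H) emptyBoard
  lower : weightSum H ℚ.≤ ℤ.+ Ls H ℚ./ 1 ℚ.+ ℤ.+ (n H * ell H) ℚ./ 8
  lower = begin
    weightSum H                                    ≡⟨ weightSum-≡ (edges H) ⟩
    ℤ.+ Ψ₀ ℚ./ 2 ^ n H                             ≤⟨ /-mono-≤ Ψ₀ (2 ^ n H) (Ls H * 8 + n H * ell H * 1) (1 * 8)
                                                         (subst₂ _≤_ (*-comm 8 Ψ₀) (sym rearrange) (Ls-bound H)) ⟩
    ℤ.+ (Ls H * 8 + n H * ell H * 1) ℚ./ (1 * 8)   ≡⟨ /-+-/ (Ls H) 1 (n H * ell H) 8 ⟨
    ℤ.+ Ls H ℚ./ 1 ℚ.+ ℤ.+ (n H * ell H) ℚ./ 8     ∎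
    where
    semiring-identity : ∀ a m l p → (a * 8 + m * l * 1) * p ≡ 8 * (a * p) + m * (l * p)
    semiring-identity = solve-∀
    rearrange = semiring-identity (Ls H) (n H) (ell H) (2 ^ n H)
  upper : ℤ.+ Rs H ℚ./ 1 ℚ.≤ weightSum H
  upper = begin
    ℤ.+ Rs H ℚ./ 1       ≤⟨ /-mono-≤ (Rs H) 1 Ψ₀ (2 ^ n H)
                              (subst (Rs H * 2 ^ n H ≤_) (sym (*-identityʳ Ψ₀))
                                     (value-R-≤-Ψ (edges H) (n H) emptyBoard)) ⟩
    ℤ.+ Ψ₀ ℚ./ 2 ^ n H   ≡⟨ weightSum-≡ (edges H) ⟨
    weightSum H          ∎
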